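{- Let $n$ be a positive integer and let $B_n$, $\epsilon$, $\phi$ be as in the context. Let $\sigma\in S_n\le B_n$ have disjoint cycle decomposition (including fixed points as cycles of length $1$) \[ C_1=(i_{1,1}\,\dots\,i_{1,d_1}),\ \dots,\ C_j=(i_{j,1}\,\dots\,i_{j,d_j}),\qquad \sum_{r=1}^j d_r=n, \] and let $\tau\in C_{B_n}(\sigma)=\{\tau\in B_n:\sigma\tau=\tau\sigma\}$. Then there exists a unique choice of $\tau'\in C_{S_n}(\sigma)$ and $\lambda_1,\dots,\lambda_j\in\mathbb Z/2\mathbb Z$ such that \[ \tau=\tau' v,\qquad v=\sum_{r=1}^j\lambda_r\,(e_{i_{r,1}}+\dots+e_{i_{r,d_r}}), \] and moreover \[ \phi(\sigma,\tau)=\epsilon^{\sum_{r=1}^j\lambda_r(d_r-1)}. \]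
   Context: Let $B_n=(\mathbb Z/2\mathbb Z)^n\rtimes S_n$ be the hyperoctahedral group, where $S_n$ acts on $(\mathbb Z/2\mathbb Z)^n$ by permuting coordinates ($\sigma(e_i)=e_{\sigma(i)}$, $e_i$ the $i$th unit vector); $S_n$ and $(\mathbb Z/2\mathbb Z)^n$ are viewed as subgroups of $B_n$, and $C_{S_n}(\sigma)$ denotes the centralizer of $\sigma$ in $S_n$. Let $H_n$ be the set of pairs $(a,b)\in(\mathbb Z/2\mathbb Z)^n\times\mathbb Z/2\mathbb Z$ with the group law $(a_1,b_1)(a_2,b_2)=(a_1+a_2,\ b_1+b_2+\sum_{1\le i<j\le n}a_{1,i}a_{2,j})$. Put $x_i=(e_i,0)$, $\epsilon=(0,1)$; then $H_n$ is presented by generators $x_1,\dots,x_n,\epsilon$ with relations $x_i^2=\epsilon^2=1$, $x_ix_j=\epsilon x_jx_i$ ($i\ne j$), $\epsilon x_i=x_i\epsilon$. $S_n$ acts on $H_n$ by automorphisms via $\sigma(x_i)=x_{\sigma(i)}$, $\sigma(\epsilon)=\epsilon$; let $G_n=H_n\rtimes S_n$. Then $\epsilon$ is central in $G_n$ and $G_n/\{1,\epsilon\}\cong B_n$ (induced by $(a,b)\mapsto a$ on $H_n$ and the identity on $S_n$), so $G_n$ is a central extension of $B_n$ by $\mathbb Z/2\mathbb Z$. For commuting $\sigma,\tau\in B_n$ with lifts $\widetilde\sigma,\widetilde\tau\in G_n$, define $\phi(\sigma,\tau)=\widetilde\sigma\widetilde\tau\widetilde\sigma^{ -1}\widetilde\tau^{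 -1}\in\{1,\epsilon\}$, which is independent of the choice of lifts. -}

module Defs where

open import Data.Bool using (Bool; true; false; _xor_; _∧_; if_then_else_; not)
open import Data.Nat using (ℕ; zero; suc; _∸_; _<ᵇ_; _<?_; s≤s)
open import Data.Fin using (Fin; zero; suc; toℕ; fromℕ<; _≟_)
open import Data.List using (List; foldr; map; allFin)
open import Data.Nat.ListAction using (sum)
open import Data.Product using (Σ; _×_; _,_; proj₁; proj₂)
open import Relation.Nullary using (does; yes; no)
open import Relation.Binary.PropositionalEquality using (_≡_)
open import Data.Fin.Permutation as P using (Permutation′; _⟨$⟩ʳ_; _⟨$⟩ˡ_; _∘ₚ_; flip)

-- Z/2Z is modelled by Bool (false = 0, true = 1, addition = xor).

xorSum : List Bool → Bool
xorSum = foldr _xor_ false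

parity : ℕ → Bool
parity zero    = false
parity (suc k) = not (parity k)

Vec₂ : ℕ → Set
Vec₂ n = Fin n → Bool

_+ᵥ_ : ∀ {n} → Vec₂ n → Vec₂ n → Vec₂ n
(a +ᵥ b) i = a i xor b i

0ᵥ : ∀ {n} → Vec₂ n
0ᵥ _ = false

e : ∀ {n} → Fin n → Vec₂ n
e k i = does (i ≟ k)

-- S_n : permutations of Fin n, composed as functions: (σ ∘ τ)(x) = σ(τ(x)).

Perm : ℕ → Set
Perm n = Permutation′ n

_∘ₛ_ : ∀ {n} → Perm n → Perm n → Perm n
σ ∘ₛ τ = τ ∘ₚ σ

idₛ : ∀ {n} → Perm n
idₛ = P.id

_⁻¹ₛ : ∀ {n} → Perm n → Perm n
σ ⁻¹ₛ = flip σ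

_≈ₛ_ : ∀ {n} → Perm n → Perm n → Set
σ ≈ₛ τ = ∀ i → σ ⟨$⟩ʳ i ≡ τ ⟨$⟩ʳ i

-- action of S_n on (Z/2Z)^n : σ(e_i) = e_{σ(i)}, i.e. (σ·a)_k = a_{σ⁻¹(k)}
actᵥ : ∀ {n} → Perm n → Vec₂ n → Vec₂ n
actᵥ σ a k = a (σ ⟨$⟩ˡ k)

-- B_n = (Z/2Z)^n ⋊ S_n.  The pair (a , σ) denotes the product a·σ.

record Bₙ (n : ℕ) : Set where
  constructor _,ᴮ_
  field
    vec  : Vec₂ n
    perm : Perm n
open Bₙ public

_·ᴮ_ : ∀ {n} → Bₙ n → Bₙ n → Bₙ n
(a ,ᴮ σ) ·ᴮ (b ,ᴮ τ) = (a +ᵥ actᵥ σ b) ,ᴮ (σ ∘ₛ τ)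

_≈ᴮ_ : ∀ {n} → Bₙ n → Bₙ n → Set
x ≈ᴮ y = (∀ i → vec x i ≡ vec y i) × (perm x ≈ₛ perm y)

permᴮ : ∀ {n} → Perm n → Bₙ n
permᴮ σ = 0ᵥ ,ᴮ σ

vecᴮ : ∀ {n} → Vec₂ n → Bₙ n
vecᴮ a = a ,ᴮ idₛ

Hₙ : ℕ → Set
Hₙ n = Vec₂ n × Bool

cocycle : ∀ {n} → Vec₂ n → Vec₂ n → Bool
cocycle {n} a₁ a₂ =
  xorSum (map (λ i → a₁ i ∧ xorSum (map (λ j → (toℕ i <ᵇ toℕ j) ∧ a₂ j) (allFin n))) (allFin n))

_·ᴴ_ : ∀ {n} → Hₙ n → Hₙ n → Hₙ n
(a₁ , b₁) ·ᴴ (a₂ , b₂) = (a₁ +ᵥ a₂) , ((b₁ xor b₂) xor cocycle a₁ a₂)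

1ᴴ : ∀ {n} → Hₙ n
1ᴴ = 0ᵥ , false

_⁻¹ᴴ : ∀ {n} → Hₙ n → Hₙ n
(a , b) ⁻¹ᴴ = a , (b xor cocycle a a)

xᴴ : ∀ {n} → Fin n → Hₙ n
xᴴ i = e i , false

εᴴ : ∀ {n} → Hₙ n
εᴴ = 0ᵥ , true

-- The automorphism of H_n induced by σ (σ(x_i) = x_{σ(i)}, σ(ε) = ε),
-- evaluated on the normal form (a , b) = ε^b · x_{n}^{a_n} ⋯ x_{1}^{a_1}
-- (product of generators in decreasing index order).
actᴴ : ∀ {n} → Perm n → Hₙ n → Hₙ n
actᴴ {n} σ (a , b) =
  foldr (λ i acc → acc ·ᴴ (if a i then xᴴ (σ ⟨$⟩ʳ i) else 1ᴴ)) (0ᵥ , b) (allFin n)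

-- G_n = H_n ⋊ S_n.  The pair (h , σ) denotes the product h·σ.

record Gₙ (n : ℕ) : Set where
  constructor _,ᴳ_
  field
    hpart : Hₙ n
    gperm : Perm n
open Gₙ public

_·ᴳ_ : ∀ {n} → Gₙ n → Gₙ n → Gₙ n
(h₁ ,ᴳ σ₁) ·ᴳ (h₂ ,ᴳ σ₂) = (h₁ ·ᴴ actᴴ σ₁ h₂) ,ᴳ (σ₁ ∘ₛ σ₂)

-- (h σ)⁻¹ = σ⁻¹ h⁻¹ = σ⁻¹(h⁻¹) σ⁻¹
_⁻¹ᴳ : ∀ {n} → Gₙ n → Gₙ n
(h ,ᴳ σ) ⁻¹ᴳ = actᴴ (σ ⁻¹ₛ) (h ⁻¹ᴴ) ,ᴳ (σ ⁻¹ₛ)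

_≈ᴳ_ : ∀ {n} → Gₙ n → Gₙ n → Set
g ≈ᴳ g' = (∀ i → proj₁ (hpart g) i ≡ proj₁ (hpart g') i)
        × (proj₂ (hpart g) ≡ proj₂ (hpart g'))
        × (gperm g ≈ₛ gperm g')

εᴳ^ : ∀ {n} → ℕ → Gₙ n
εᴳ^ k = (0ᵥ , parity k) ,ᴳ idₛ

lift : ∀ {n} → Bₙ n → Gₙ n
lift (a ,ᴮ σ) = (a , false) ,ᴳ σ

-- φ(σ , τ) = σ̃ τ̃ σ̃⁻¹ τ̃⁻¹  (for commuting σ, τ it lies in {1 , ε};
-- it is independent of the lifts, so we use the canonical ones)
φ : ∀ {n} → Bₙ n → Bₙ n → Gₙ n
φ σ τ = ((lift σ ·ᴳ lift τ) ·ᴳ (lift σ ⁻¹ᴳ)) ·ᴳ (lift τ ⁻¹ᴳ)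

-- Disjoint cycle decomposition of σ ∈ S_n (fixed points included):
-- cycles C_r = (i_{r,1} … i_{r,d_r}), r ∈ Fin j, all elements listed
-- exactly once, σ(i_{r,k}) = i_{r,k+1} with indices mod d_r.

sucMod : ∀ {m} → Fin m → Fin m
sucMod {suc m} k with toℕ k <? m
... | yes p = fromℕ< (s≤s p)
... | no _  = zero

record CycleDecomp (n : ℕ) (σ : Perm n) : Set where
  field
    j      : ℕ
    d      : Fin j → ℕ
    d-pos  : ∀ r → 0 Data.Nat.< d r
    idx    : (r : Fin j) → Fin (d r) → Fin n
    idx-inj  : ∀ r r' (k : Fin (d r)) (k' : Fin (d r')) →
               idx r k ≡ idx r' k' → (r ≡ r') × (toℕ k ≡ toℕ k')
    idx-surj : ∀ i → Σ (Fin j) λ r → Σ (Fin (d r)) λ k → idx r k ≡ i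
    cyclic : ∀ r k → σ ⟨$⟩ʳ idx r k ≡ idx r (sucMod k)
open CycleDecomp public

cycleVec : ∀ {n σ} (D : CycleDecomp n σ) → (Fin (j D) → Bool) → Vec₂ n
cycleVec {n} D λ′ =
  foldr _+ᵥ_ 0ᵥ (map (λ r → if λ′ r
                               then foldr _+ᵥ_ 0ᵥ (map (λ k → e (idx D r k)) (allFin (d D r)))
                               else 0ᵥ)
                     (allFin (j D)))

exponent : ∀ {n σ} (D : CycleDecomp n σ) → (Fin (j D) → Bool) → ℕ
exponent D λ′ = sum (map (λ r → if λ′ r then d D r ∸ 1 else 0) (allFin (j D)))

IsDecomposition : ∀ {n σ} (D : CycleDecomp n σ) → Bₙ n → Perm n → (Fin (j D) → Bool) → Set
IsDecomposition {σ = σ} D τ τ' λ′ =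
  ((σ ∘ₛ τ') ≈ₛ (τ' ∘ₛ σ)) × (τ ≈ᴮ (permᴮ τ' ·ᴮ vecᴮ (cycleVec D λ′)))

-- For h = (a , b) ∈ H_n and s ∈ S_n, conjugation by s multiplies out the normal form of h and
-- gives s(a , b) = (s a , b + inv_s(a)), where inv_s(a) is the parity of the number of
-- inversions of s between points of the support of a.  If τ = a π commutes with σ, then a is
-- σ-invariant and π commutes with σ; the commutator of the lifts of σ and τ then collapses to
-- ε^{inv_σ(a)}.  Commutation also makes a ∘ π constant on every σ-cycle C_r, which is exactly
-- τ = π v with v = Σ λ_r e_{C_r}, the λ_r being read off as a(π(i_{r,1})).  Finally inv_σ is a
-- quadratic form over Z/2Z whose polarisation is c(σ v, σ w) + c(v, w), c the cocycle of H_n;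
-- it vanishes on σ-invariant vectors, so inv_σ(a) = Σ_r λ_r inv_σ(π C_r), and the σ-cycle
-- π C_r of length d_r contributes d_r − 1.

module Submission where

open import Defs
open import Level using (0ℓ)
open import Data.Bool using (Bool; true; false; _xor_; _∧_; not; if_then_else_)
open import Data.Bool.Properties
  using ( xor-assoc; xor-comm; xor-identityʳ; xor-same; xor-inverseʳ; not-distribˡ-xor
        ; ∧-comm; ∧-zeroʳ; ∧-identityʳ; ∧-distribˡ-xor; ∧-distribʳ-xor; xor-∧-commutativeRing)
open import Data.Empty using (⊥-elim)
open import Data.Nat using (ℕ; zero; suc; _+_; _∸_; _<_; _<ᵇ_; _<?_; s≤s)
import Data.Nat.Properties as ℕ
open import Data.Nat.ListAction using (sum)
open import Data.Fin using (Fin; zero; suc; _≟_; toℕ; inject₁; fromℕ; fromℕ<)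
open import Data.Fin.Properties using (toℕ-injective; toℕ-fromℕ<; toℕ-inject₁; toℕ<n; toℕ-fromℕ; 0≢1+n)
open import Data.Fin.Induction using (<-weakInduction)
open import Data.Fin.Permutation as P using (_⟨$⟩ʳ_; _⟨$⟩ˡ_)
open import Data.List using (List; []; _∷_; map; foldr; allFin; tabulate; _++_; [_])
open import Data.List.Properties using (map-tabulate)
open import Data.Maybe using (nothing)
open import Data.Product using (Σ; _×_; _,_; proj₁; proj₂)
open import Function using (_∘_; id; mk⇔; Injection)
open import Function.Properties.Inverse using (↔⇒↣)
open import Relation.Nullary using (yes; no)
open import Relation.Nullary.Decidable using (does; does-⇔; dec-false)
open import Relation.Binary.Bundles using (Setoid)
open import Relation.Binary.PropositionalEquality hiding ([_])
import Relation.Binary.Reasoning.Setoid as SetoidReasoning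
open import Tactic.RingSolver using (solve-∀)
open import Tactic.RingSolver.Core.AlmostCommutativeRing using (AlmostCommutativeRing; fromCommutativeRing)

private
  variable
    n m : ℕ
    A B : Set

boolRing : AlmostCommutativeRing 0ℓ 0ℓ
boolRing = fromCommutativeRing xor-∧-commutativeRing (λ _ → nothing)

xor-interchange : ∀ a b c d → (a xor b) xor (c xor d) ≡ (a xor c) xor (b xor d)
xor-interchange = solve-∀ boolRing

xor-cancelʳ : ∀ x y → (x xor y) xor y ≡ x
xor-cancelʳ x y = trans (xor-assoc x y y) (trans (cong (x xor_) (xor-same y)) (xor-identityʳ x))

⨁ : List A → (A → Bool) → Bool
⨁ L f = xorSum (map f L)

∑ : (Fin n → Bool) → Bool
∑ {n} = ⨁ (allFin n)

⨁-cong : (L : List A) {f g : A → Bool} → (∀ x → f x ≡ g x) → ⨁ L f ≡ ⨁ L g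
⨁-cong []      f≗g = refl
⨁-cong (x ∷ L) f≗g = cong₂ _xor_ (f≗g x) (⨁-cong L f≗g)

⨁-false : (L : List A) → ⨁ L (λ _ → false) ≡ false
⨁-false []      = refl
⨁-false (_ ∷ L) = ⨁-false L

⨁-xor : (L : List A) (f g : A → Bool) → ⨁ L (λ x → f x xor g x) ≡ ⨁ L f xor ⨁ L g
⨁-xor []      f g = refl
⨁-xor (x ∷ L) f g = trans (cong ((f x xor g x) xor_) (⨁-xor L f g)) (xor-interchange (f x) (g x) (⨁ L f) (⨁ L g))

∧-distribˡ-⨁ : (b : Bool) (L : List A) (f : A → Bool) → b ∧ ⨁ L f ≡ ⨁ L (λ x → b ∧ f x)
∧-distribˡ-⨁ true  L f = refl
∧-distribˡ-⨁ false L f = sym (⨁-false L)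

∧-distribʳ-⨁ : (b : Bool) (L : List A) (f : A → Bool) → ⨁ L f ∧ b ≡ ⨁ L (λ x → f x ∧ b)
∧-distribʳ-⨁ b L f =
  trans (∧-comm (⨁ L f) b) (trans (∧-distribˡ-⨁ b L f) (⨁-cong L (λ x → ∧-comm b (f x))))

⨁-comm : (L : List A) (M : List B) (f : A → B → Bool) →
         ⨁ L (λ x → ⨁ M (f x)) ≡ ⨁ M (λ y → ⨁ L (λ x → f x y))
⨁-comm []      M f = sym (⨁-false M)
⨁-comm (x ∷ L) M f = trans (cong (⨁ M (f x) xor_) (⨁-comm L M f)) (sym (⨁-xor M (f x) _))

⨁-map : (h : A → B) (L : List A) (f : B → Bool) → ⨁ (map h L) f ≡ ⨁ L (f ∘ h)
⨁-map h []      f = refl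
⨁-map h (x ∷ L) f = cong (f (h x) xor_) (⨁-map h L f)

⨁-++ : (L M : List A) (f : A → Bool) → ⨁ (L ++ M) f ≡ ⨁ L f xor ⨁ M f
⨁-++ []      M f = refl
⨁-++ (x ∷ L) M f = trans (cong (f x xor_) (⨁-++ L M f)) (sym (xor-assoc (f x) _ _))

⨁-tabulate : (g : Fin n → A) (f : A → Bool) → ⨁ (tabulate g) f ≡ ∑ (f ∘ g)
⨁-tabulate {n} g f = trans (cong (λ L → ⨁ L f) (sym (map-tabulate id g))) (⨁-map g (allFin n) f)

∑-cong : {f g : Fin n → Bool} → (∀ i → f i ≡ g i) → ∑ f ≡ ∑ g
∑-cong = ⨁-cong (allFin _)

∑-suc : (f : Fin (suc n) → Bool) → ∑ f ≡ f zero xor ∑ (f ∘ suc)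
∑-suc f = cong (f zero xor_) (⨁-tabulate suc f)

∑-δ : (x : Fin n) (g : Fin n → Bool) → ∑ (λ u → does (u ≟ x) ∧ g u) ≡ g x
∑-δ {suc n} zero    g =
  trans (∑-suc (λ u → does (u ≟ zero) ∧ g u)) (trans (cong (g zero xor_) (⨁-false (allFin n))) (xor-identityʳ _))
∑-δ {suc n} (suc x) g = trans (∑-suc (λ u → does (u ≟ suc x) ∧ g u)) (∑-δ x (g ∘ suc))

∑-true : ∀ n → ∑ {n} (λ _ → true) ≡ parity n
∑-true zero    = refl
∑-true (suc n) = trans (∑-suc {n} (λ _ → true)) (cong not (∑-true n))

parity-+ : ∀ m n → parity (m + n) ≡ parity m xor parity n
parity-+ zero    n = refl
parity-+ (suc m) n = trans (cong not (parity-+ m n)) (not-distribˡ-xor (parity m) (parity n))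

parity-sum : (f : A → ℕ) (L : List A) → parity (sum (map f L)) ≡ ⨁ L (parity ∘ f)
parity-sum f []      = refl
parity-sum f (x ∷ L) = trans (parity-+ (f x) (sum (map f L))) (cong (parity (f x) xor_) (parity-sum f L))

≟-shift : (s : Perm n) (u i : Fin n) → does (u ≟ s ⟨$⟩ʳ i) ≡ does (i ≟ s ⟨$⟩ˡ u)
≟-shift s u i = does-⇔ (mk⇔ (λ u≡si → trans (sym (P.inverseˡ s)) (cong (s ⟨$⟩ˡ_) (sym u≡si)))
                            (λ i≡s⁻¹u → trans (sym (P.inverseʳ s)) (cong (s ⟨$⟩ʳ_) (sym i≡s⁻¹u))))
                       (u ≟ s ⟨$⟩ʳ i) (i ≟ s ⟨$⟩ˡ u)

≟-sym : (x y : Fin n) → does (x ≟ y) ≡ does (y ≟ x)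
≟-sym x y = does-⇔ (mk⇔ sym sym) (x ≟ y) (y ≟ x)

⟨$⟩ˡ-cong : {s s' : Perm n} → s ≈ₛ s' → ∀ u → s ⟨$⟩ˡ u ≡ s' ⟨$⟩ˡ u
⟨$⟩ˡ-cong {s = s} {s'} s≈s' u =
  trans (sym (P.inverseˡ s')) (cong (s' ⟨$⟩ˡ_) (trans (sym (s≈s' _)) (P.inverseʳ s)))

∑-reindex : (s : Perm n) (f : Fin n → Bool) → ∑ f ≡ ∑ (λ i → f (s ⟨$⟩ʳ i))
∑-reindex {n} s f = begin
  ∑ f
    ≡⟨ ∑-cong (λ u → sym (trans (∑-δ (s ⟨$⟩ˡ u) _) (cong f (P.inverseʳ s)))) ⟩
  ∑ (λ u → ∑ λ i → does (i ≟ s ⟨$⟩ˡ u) ∧ f (s ⟨$⟩ʳ i))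
    ≡⟨ ⨁-comm (allFin n) (allFin n) _ ⟩
  ∑ (λ i → ∑ λ u → does (i ≟ s ⟨$⟩ˡ u) ∧ f (s ⟨$⟩ʳ i))
    ≡⟨ ∑-cong (λ i → ∑-cong (λ u → cong (_∧ f (s ⟨$⟩ʳ i)) (sym (≟-shift s u i)))) ⟩
  ∑ (λ i → ∑ λ u → does (u ≟ s ⟨$⟩ʳ i) ∧ f (s ⟨$⟩ʳ i))
    ≡⟨ ∑-cong (λ i → ∑-δ (s ⟨$⟩ʳ i) (λ _ → f (s ⟨$⟩ʳ i))) ⟩
  ∑ (λ i → f (s ⟨$⟩ʳ i)) ∎
  where open ≡-Reasoning

lt : Fin n → Fin n → Bool
lt i j = toℕ i <ᵇ toℕ j

⨁pairs : (A → A → Bool) → List A → Bool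
⨁pairs g []      = false
⨁pairs g (x ∷ L) = ⨁pairs g L xor ⨁ L (g x)

⨁pairs-cong : (L : List A) {g h : A → A → Bool} → (∀ x y → g x y ≡ h x y) → ⨁pairs g L ≡ ⨁pairs h L
⨁pairs-cong []      g≗h = refl
⨁pairs-cong (x ∷ L) g≗h = cong₂ _xor_ (⨁pairs-cong L g≗h) (⨁-cong L (g≗h x))

⨁pairs-false : (L : List A) → ⨁pairs (λ _ _ → false) L ≡ false
⨁pairs-false []      = refl
⨁pairs-false (x ∷ L) = cong₂ _xor_ (⨁pairs-false L) (⨁-false L)

⨁pairs-xor : (L : List A) (g h : A → A → Bool) →
             ⨁pairs (λ x y → g x y xor h x y) L ≡ ⨁pairs g L xor ⨁pairs h L
⨁pairs-xor []      g h = refl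
⨁pairs-xor (x ∷ L) g h = trans (cong₂ _xor_ (⨁pairs-xor L g h) (⨁-xor L (g x) (h x)))
                               (xor-interchange (⨁pairs g L) (⨁pairs h L) (⨁ L (g x)) (⨁ L (h x)))

⨁pairs-map : (h : A → B) (L : List A) (g : B → B → Bool) →
             ⨁pairs g (map h L) ≡ ⨁pairs (λ x y → g (h x) (h y)) L
⨁pairs-map h []      g = refl
⨁pairs-map h (x ∷ L) g = cong₂ _xor_ (⨁pairs-map h L g) (⨁-map h L (g (h x)))

⨁pairs-tabulate : (h : Fin n → A) (g : A → A → Bool) →
                  ⨁pairs g (tabulate h) ≡ ⨁pairs (λ i j → g (h i) (h j)) (allFin n)
⨁pairs-tabulate {n} h g = trans (cong (⨁pairs g) (sym (map-tabulate id h))) (⨁pairs-map h (allFin n) g)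

⨁pairs-snoc : (L : List A) (z : A) (g : A → A → Bool) →
              ⨁pairs g (L ++ [ z ]) ≡ ⨁pairs g L xor ⨁ L (λ x → g x z)
⨁pairs-snoc []      z g = refl
⨁pairs-snoc (x ∷ L) z g =
  trans (cong₂ _xor_ (⨁pairs-snoc L z g)
                     (trans (⨁-++ L [ z ] (g x)) (cong (⨁ L (g x) xor_) (xor-identityʳ (g x z)))))
        (shuffle (⨁pairs g L) (⨁ L (λ y → g y z)) (⨁ L (g x)) (g x z))
  where
  shuffle : ∀ a b c d → (a xor b) xor (c xor d) ≡ (a xor c) xor (d xor b)
  shuffle = solve-∀ boolRing

⨁pairs-allFin-suc : (g : Fin (suc n) → Fin (suc n) → Bool) →
                    ⨁pairs g (allFin (suc n)) ≡ ⨁pairs (λ i j → g (suc i) (suc j)) (allFin n) xor ∑ (g zero ∘ suc)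
⨁pairs-allFin-suc g = cong₂ _xor_ (⨁pairs-tabulate suc g) (⨁-tabulate suc (g zero))

⨁pairs-allFin : (g : Fin n → Fin n → Bool) → ⨁pairs g (allFin n) ≡ ∑ λ i → ∑ λ j → lt i j ∧ g i j
⨁pairs-allFin {zero}  g = refl
⨁pairs-allFin {suc n} g = begin
  ⨁pairs g (allFin (suc n))
    ≡⟨ trans (⨁pairs-allFin-suc g) (cong (_xor ∑ (g zero ∘ suc)) (⨁pairs-allFin (λ i j → g (suc i) (suc j)))) ⟩
  (∑ λ i → ∑ λ j → lt i j ∧ g (suc i) (suc j)) xor ∑ (g zero ∘ suc)
    ≡⟨ xor-comm (∑ λ i → ∑ λ j → lt i j ∧ g (suc i) (suc j)) (∑ (g zero ∘ suc)) ⟩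
  ∑ (g zero ∘ suc) xor (∑ λ i → ∑ λ j → lt i j ∧ g (suc i) (suc j))
    ≡⟨ sym (cong₂ _xor_ (∑-suc (λ j → lt zero j ∧ g zero j))
                        (∑-cong (λ i → ∑-suc (λ j → lt (suc i) j ∧ g (suc i) j)))) ⟩
  (∑ λ j → lt zero j ∧ g zero j) xor (∑ λ i → ∑ λ j → lt (suc i) j ∧ g (suc i) j)
    ≡⟨ sym (∑-suc (λ i → ∑ λ j → lt i j ∧ g i j)) ⟩
  (∑ λ i → ∑ λ j → lt i j ∧ g i j) ∎
  where open ≡-Reasoning

vsum : List A → (A → Vec₂ n) → Vec₂ n
vsum L v = foldr _+ᵥ_ 0ᵥ (map v L)

vsum-apply : (L : List A) (v : A → Vec₂ n) (u : Fin n) → vsum L v u ≡ ⨁ L (λ x → v x u)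
vsum-apply []      v u = refl
vsum-apply (x ∷ L) v u = cong (v x u xor_) (vsum-apply L v u)

Form : ℕ → Set
Form n = Fin n → Fin n → Bool

infixl 6 _+ᶠ_
infix 8 _ᵀ

_+ᶠ_ : Form n → Form n → Form n
(P +ᶠ Q) i j = P i j xor Q i j

_ᵀ : Form n → Form n
(P ᵀ) i j = P j i

-- Chosen so that cocycle a b is definitionally bilin lt a b.
bilin : Form n → Vec₂ n → Vec₂ n → Bool
bilin P a b = ∑ λ i → a i ∧ ∑ λ j → P i j ∧ b j

quad : Form n → Vec₂ n → Bool
quad P a = bilin P a a

bilin-cong : {P Q : Form n} {a a' b b' : Vec₂ n} → (∀ i j → P i j ≡ Q i j) →
             (∀ i → a i ≡ a' i) → (∀ j → b j ≡ b' j) → bilin P a b ≡ bilin Q a' b'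
bilin-cong {n} P≗Q a≗a' b≗b' =
  ∑-cong (λ i → cong₂ _∧_ (a≗a' i) (∑-cong (λ j → cong₂ _∧_ (P≗Q i j) (b≗b' j))))

bilin-double : (P : Form n) (a b : Vec₂ n) → bilin P a b ≡ ∑ λ i → ∑ λ j → a i ∧ (P i j ∧ b j)
bilin-double {n} P a b = ∑-cong (λ i → ∧-distribˡ-⨁ (a i) (allFin n) _)

bilin-+ᶠ : (P Q : Form n) (a b : Vec₂ n) → bilin (P +ᶠ Q) a b ≡ bilin P a b xor bilin Q a b
bilin-+ᶠ {n} P Q a b = begin
  bilin (P +ᶠ Q) a b
    ≡⟨ bilin-double (P +ᶠ Q) a b ⟩
  (∑ λ i → ∑ λ j → a i ∧ ((P i j xor Q i j) ∧ b j))
    ≡⟨ ∑-cong (λ i → trans (∑-cong (λ j → expand (a i) (P i j) (Q i j) (b j)))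
                                      (⨁-xor (allFin n) _ _)) ⟩
  (∑ λ i → (∑ λ j → a i ∧ (P i j ∧ b j)) xor (∑ λ j → a i ∧ (Q i j ∧ b j)))
    ≡⟨ ⨁-xor (allFin n) _ _ ⟩
  (∑ λ i → ∑ λ j → a i ∧ (P i j ∧ b j)) xor (∑ λ i → ∑ λ j → a i ∧ (Q i j ∧ b j))
    ≡⟨ sym (cong₂ _xor_ (bilin-double P a b) (bilin-double Q a b)) ⟩
  bilin P a b xor bilin Q a b ∎
  where
  open ≡-Reasoning
  expand : ∀ x p q y → x ∧ ((p xor q) ∧ y) ≡ (x ∧ (p ∧ y)) xor (x ∧ (q ∧ y))
  expand = solve-∀ boolRing

bilin-+ˡ : (P : Form n) (a a' b : Vec₂ n) → bilin P (a +ᵥ a') b ≡ bilin P a b xor bilin P a' b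
bilin-+ˡ {n} P a a' b = trans (∑-cong (λ i → ∧-distribʳ-xor _ (a i) (a' i))) (⨁-xor (allFin n) _ _)

bilin-+ʳ : (P : Form n) (a b b' : Vec₂ n) → bilin P a (b +ᵥ b') ≡ bilin P a b xor bilin P a b'
bilin-+ʳ {n} P a b b' =
  trans (∑-cong (λ i → trans (cong (a i ∧_) (trans (∑-cong (λ j → ∧-distribˡ-xor (P i j) (b j) (b' j)))
                                                   (⨁-xor (allFin n) _ _)))
                             (∧-distribˡ-xor (a i) _ _)))
        (⨁-xor (allFin n) _ _)

bilin-0ʳ : (P : Form n) (a : Vec₂ n) → bilin P a 0ᵥ ≡ false
bilin-0ʳ {n} P a =
  trans (∑-cong (λ i → trans (cong (a i ∧_) (trans (∑-cong (λ j → ∧-zeroʳ (P i j)))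
                                                                (⨁-false (allFin n))))
                                        (∧-zeroʳ (a i))))
        (⨁-false (allFin n))

bilin-transpose : (P : Form n) (a b : Vec₂ n) → bilin P b a ≡ bilin (P ᵀ) a b
bilin-transpose {n} P a b = begin
  bilin P b a                                     ≡⟨ bilin-double P b a ⟩
  (∑ λ i → ∑ λ j → b i ∧ (P i j ∧ a j))          ≡⟨ ⨁-comm (allFin n) (allFin n) _ ⟩
  (∑ λ j → ∑ λ i → b i ∧ (P i j ∧ a j))          ≡⟨ ∑-cong (λ j → ∑-cong (λ i → swap (b i) (P i j) (a j))) ⟩
  (∑ λ j → ∑ λ i → a j ∧ ((P ᵀ) j i ∧ b i))      ≡⟨ sym (bilin-double (P ᵀ) a b) ⟩
  bilin (P ᵀ) a b                                 ∎
  where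
  open ≡-Reasoning
  swap : ∀ x p y → x ∧ (p ∧ y) ≡ y ∧ (p ∧ x)
  swap = solve-∀ boolRing

∑-∧-δ : (y : Fin n) (g : Fin n → Bool) → (∑ λ j → g j ∧ e y j) ≡ g y
∑-∧-δ {n} y g = trans (∑-cong (λ j → ∧-comm (g j) (e y j))) (∑-δ y g)

bilin-eʳ : (P : Form n) (a : Vec₂ n) (y : Fin n) → bilin P a (e y) ≡ ∑ λ i → a i ∧ P i y
bilin-eʳ {n} P a y = ∑-cong (λ i → cong (a i ∧_) (∑-∧-δ y (P i)))

bilin-e : (P : Form n) (x y : Fin n) → bilin P (e x) (e y) ≡ P x y
bilin-e P x y = trans (bilin-eʳ P (e x) y) (∑-δ x (λ i → P i y))

bilin-act : (s : Perm n) (P : Form n) (a b : Vec₂ n) →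
            bilin P (actᵥ s a) (actᵥ s b) ≡ bilin (λ i j → P (s ⟨$⟩ʳ i) (s ⟨$⟩ʳ j)) a b
bilin-act {n} s P a b =
  trans (∑-reindex s _)
        (∑-cong (λ i → cong₂ _∧_ (cong a (P.inverseˡ s))
                                 (trans (∑-reindex s _)
                                        (∑-cong (λ j → cong (P (s ⟨$⟩ʳ i) (s ⟨$⟩ʳ j) ∧_) (cong b (P.inverseˡ s)))))))

bilin-vsumʳ : (P : Form n) (a : Vec₂ n) (L : List A) (v : A → Vec₂ n) →
              bilin P a (vsum L v) ≡ ⨁ L (λ x → bilin P a (v x))
bilin-vsumʳ P a []      v = bilin-0ʳ P a
bilin-vsumʳ P a (x ∷ L) v = trans (bilin-+ʳ P a (v x) (vsum L v)) (cong (bilin P a (v x) xor_) (bilin-vsumʳ P a L v))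

quad-+ : (P : Form n) (a b : Vec₂ n) → quad P (a +ᵥ b) ≡ (quad P a xor quad P b) xor bilin (P +ᶠ P ᵀ) a b
quad-+ P a b = begin
  quad P (a +ᵥ b)
    ≡⟨ trans (bilin-+ˡ P a b (a +ᵥ b)) (cong₂ _xor_ (bilin-+ʳ P a a b) (bilin-+ʳ P b a b)) ⟩
  (quad P a xor bilin P a b) xor (bilin P b a xor quad P b)
    ≡⟨ shuffle (quad P a) (bilin P a b) (bilin P b a) (quad P b) ⟩
  (quad P a xor quad P b) xor (bilin P a b xor bilin P b a)
    ≡⟨ cong ((quad P a xor quad P b) xor_) (trans (cong (bilin P a b xor_) (bilin-transpose P a b))
                                                  (sym (bilin-+ᶠ P (P ᵀ) a b))) ⟩
  (quad P a xor quad P b) xor bilin (P +ᶠ P ᵀ) a b ∎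
  where
  open ≡-Reasoning
  shuffle : ∀ p q r s → (p xor q) xor (r xor s) ≡ (p xor s) xor (q xor r)
  shuffle = solve-∀ boolRing

quad-vsum : (P : Form n) (L : List A) (v : A → Vec₂ n) →
            quad P (vsum L v) ≡ ⨁ L (λ x → quad P (v x)) xor ⨁pairs (λ x y → bilin (P +ᶠ P ᵀ) (v x) (v y)) L
quad-vsum {n} P []      v = ⨁-false (allFin n)
quad-vsum     P (x ∷ L) v = begin
  quad P (v x +ᵥ vsum L v)
    ≡⟨ quad-+ P (v x) (vsum L v) ⟩
  (quad P (v x) xor quad P (vsum L v)) xor bilin S (v x) (vsum L v)
    ≡⟨ cong₂ (λ q c → (quad P (v x) xor q) xor c) (quad-vsum P L v) (bilin-vsumʳ S (v x) L v) ⟩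
  (quad P (v x) xor (⨁ L (quad P ∘ v) xor ⨁pairs cross L)) xor ⨁ L (cross x)
    ≡⟨ shuffle (quad P (v x)) (⨁ L (quad P ∘ v)) (⨁pairs cross L) (⨁ L (cross x)) ⟩
  (quad P (v x) xor ⨁ L (quad P ∘ v)) xor (⨁pairs cross L xor ⨁ L (cross x)) ∎
  where
  open ≡-Reasoning
  S = P +ᶠ P ᵀ
  cross = λ y z → bilin S (v y) (v z)
  shuffle : ∀ p q r s → (p xor (q xor r)) xor s ≡ (p xor q) xor (r xor s)
  shuffle = solve-∀ boolRing

<ᵇ-irrefl : ∀ m → (m <ᵇ m) ≡ false
<ᵇ-irrefl zero    = refl
<ᵇ-irrefl (suc m) = <ᵇ-irrefl m

<ᵇ-flip : ∀ m n → m ≢ n → (n <ᵇ m) ≡ not (m <ᵇ n)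
<ᵇ-flip zero    zero    m≢n = ⊥-elim (m≢n refl)
<ᵇ-flip zero    (suc n) m≢n = refl
<ᵇ-flip (suc m) zero    m≢n = refl
<ᵇ-flip (suc m) (suc n) m≢n = <ᵇ-flip m n (m≢n ∘ cong suc)

lt-irrefl : (x : Fin n) → lt x x ≡ false
lt-irrefl x = <ᵇ-irrefl (toℕ x)

lt-flip : {x y : Fin n} → x ≢ y → lt y x ≡ not (lt x y)
lt-flip {x = x} {y} x≢y = <ᵇ-flip (toℕ x) (toℕ y) (x≢y ∘ toℕ-injective)

inversions : Perm n → Form n
inversions s i j = lt i j ∧ lt (s ⟨$⟩ʳ j) (s ⟨$⟩ʳ i)

invParity : Perm n → Vec₂ n → Bool
invParity s = quad (inversions s)

invParity-cong : {s s' : Perm n} {a a' : Vec₂ n} → s ≈ₛ s' → (∀ i → a i ≡ a' i) → invParity s a ≡ invParity s' a'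
invParity-cong s≈s' a≗a' = bilin-cong (λ i j → cong (lt i j ∧_) (cong₂ lt (s≈s' j) (s≈s' i))) a≗a' a≗a'

invParity-congʳ : (s : Perm n) {a a' : Vec₂ n} → (∀ i → a i ≡ a' i) → invParity s a ≡ invParity s a'
invParity-congʳ s = invParity-cong {s = s} {s} (λ _ → refl)

inversions-symmetrized : (s : Perm n) (i j : Fin n) →
                         (inversions s +ᶠ inversions s ᵀ) i j ≡ lt (s ⟨$⟩ʳ i) (s ⟨$⟩ʳ j) xor lt i j
inversions-symmetrized s i j with i ≟ j
... | yes refl rewrite lt-irrefl i | lt-irrefl (s ⟨$⟩ʳ i) = refl
... | no i≢j rewrite lt-flip i≢j | lt-flip {x = s ⟨$⟩ʳ i} (i≢j ∘ Injection.injective (↔⇒↣ s))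
  = exclusive (lt i j) (lt (s ⟨$⟩ʳ i) (s ⟨$⟩ʳ j))
  where
  exclusive : ∀ p q → (p ∧ not q) xor (not p ∧ q) ≡ q xor p
  exclusive false q     = sym (xor-identityʳ q)
  exclusive true  false = refl
  exclusive true  true  = refl

bilin-symmetrized-inversions : (s : Perm n) (a b : Vec₂ n) →
  bilin (inversions s +ᶠ inversions s ᵀ) a b ≡ cocycle (actᵥ s a) (actᵥ s b) xor cocycle a b
bilin-symmetrized-inversions s a b =
  trans (bilin-cong (inversions-symmetrized s) (λ _ → refl) (λ _ → refl))
        (trans (bilin-+ᶠ _ lt a b) (cong (_xor cocycle a b) (sym (bilin-act s lt a b))))

invParity-inverse : (π : Perm n) (a : Vec₂ n) → invParity π (actᵥ (π ⁻¹ₛ) a) ≡ invParity (π ⁻¹ₛ) a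
invParity-inverse π a =
  trans (bilin-act (π ⁻¹ₛ) (inversions π) a a)
        (trans (bilin-cong (λ i j → trans (cong (lt (π ⟨$⟩ˡ i) (π ⟨$⟩ˡ j) ∧_)
                                                (cong₂ lt (P.inverseʳ π) (P.inverseʳ π)))
                                          (∧-comm (lt (π ⟨$⟩ˡ i) (π ⟨$⟩ˡ j)) (lt j i)))
                           (λ _ → refl) (λ _ → refl))
               (sym (bilin-transpose (inversions (π ⁻¹ₛ)) a a)))

invParity-vsum-invariant : (σ : Perm n) (L : List A) (v : A → Vec₂ n) → (∀ x u → v x (σ ⟨$⟩ˡ u) ≡ v x u) →
                           invParity σ (vsum L v) ≡ ⨁ L (invParity σ ∘ v)
invParity-vsum-invariant σ L v invariant =
  trans (quad-vsum (inversions σ) L v)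
        (trans (cong (⨁ L (invParity σ ∘ v) xor_)
                     (trans (⨁pairs-cong L cross-term-vanishes) (⨁pairs-false L)))
               (xor-identityʳ _))
  where
  cross-term-vanishes : ∀ x y → bilin (inversions σ +ᶠ inversions σ ᵀ) (v x) (v y) ≡ false
  cross-term-vanishes x y =
    trans (bilin-symmetrized-inversions σ (v x) (v y))
          (trans (cong (_xor cocycle (v x) (v y)) (bilin-cong (λ _ _ → refl) (invariant x) (invariant y)))
                 (xor-same (cocycle (v x) (v y))))

infix 4 _≃ᴴ_

_≃ᴴ_ : Hₙ n → Hₙ n → Set
h ≃ᴴ h' = (∀ i → proj₁ h i ≡ proj₁ h' i) × (proj₂ h ≡ proj₂ h')

≃ᴴ-setoid : ℕ → Setoid 0ℓ 0ℓ
≃ᴴ-setoid n = record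
  { Carrier       = Hₙ n
  ; _≈_           = _≃ᴴ_
  ; isEquivalence = record
    { refl  = (λ _ → refl) , refl
    ; sym   = λ (p , q) → (sym ∘ p) , sym q
    ; trans = λ (p , q) (p' , q') → (λ i → trans (p i) (p' i)) , trans q q'
    }
  }

∑-⨁-δ : (L : List A) (c : A → Bool) (y : A → Fin n) (h : Fin n → Bool) →
        (∑ λ u → ⨁ L (λ x → c x ∧ e (y x) u) ∧ h u) ≡ ⨁ L (λ x → c x ∧ h (y x))
∑-⨁-δ {n = n} L c y h =
  trans (∑-cong (λ u → ∧-distribʳ-⨁ (h u) L _))
        (trans (⨁-comm (allFin n) L _)
               (⨁-cong L (λ x → trans (∑-cong (λ u → reorder (c x) (e (y x) u) (h u)))
                                      (∑-δ (y x) (λ u → c x ∧ h u)))))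
  where
  reorder : ∀ p q r → (p ∧ q) ∧ r ≡ q ∧ (p ∧ r)
  reorder = solve-∀ boolRing

·ᴴ-x^ : (v : Vec₂ n) (β c : Bool) (k : Fin n) →
        ((v , β) ·ᴴ (if c then xᴴ k else 1ᴴ))
          ≃ᴴ ((λ u → (c ∧ e k u) xor v u) , β xor (c ∧ ∑ λ i → v i ∧ lt i k))
·ᴴ-x^ v β true  k = (λ u → xor-comm (v u) (e k u)) , cong₂ _xor_ (xor-identityʳ β) (bilin-eʳ lt v k)
·ᴴ-x^ v β false k = (λ u → xor-identityʳ (v u)) , cong₂ _xor_ (xor-identityʳ β) (bilin-0ʳ lt v)

-- actᴴ s multiplies out x_{s n}^{a_n} ⋯ x_{s 1}^{a_1} from the left; appending x_{s i} costs, through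
-- the cocycle, one ε for each earlier factor x_{s j} (j > i) with s j < s i, i.e. for each inversion
-- of s on the support of a.
actᴴ-closed : (s : Perm n) (a : Vec₂ n) (b : Bool) → actᴴ s (a , b) ≃ᴴ (actᵥ s a , b xor invParity s a)
actᴴ-closed {n} s a b =
  let (p₁ , p₂) = fold (allFin n) in
  (λ u → trans (p₁ u) (entries u)) , trans p₂ (cong (b xor_) (trans (⨁pairs-allFin g) triangle))
  where
  g : Fin n → Fin n → Bool
  g i j = a i ∧ (a j ∧ lt (s ⟨$⟩ʳ j) (s ⟨$⟩ʳ i))
  step : Fin n → Hₙ n → Hₙ n
  step i acc = acc ·ᴴ (if a i then xᴴ (s ⟨$⟩ʳ i) else 1ᴴ)
  fold : (L : List (Fin n)) →
         foldr step (0ᵥ , b) L ≃ᴴ ((λ u → ⨁ L (λ i → a i ∧ e (s ⟨$⟩ʳ i) u)) , b xor ⨁pairs g L)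
  fold []      = (λ _ → refl) , sym (xor-identityʳ b)
  fold (i ∷ L) =
    let (p₁ , p₂) = fold L
        (v , β)   = foldr step (0ᵥ , b) L
        (q₁ , q₂) = ·ᴴ-x^ v β (a i) (s ⟨$⟩ʳ i)
    in (λ u → trans (q₁ u) (cong ((a i ∧ e (s ⟨$⟩ʳ i) u) xor_) (p₁ u)))
     , trans q₂ (trans (cong₂ (λ β x → β xor (a i ∧ x)) p₂
                              (trans (∑-cong (λ u → cong (_∧ lt u (s ⟨$⟩ʳ i)) (p₁ u)))
                                     (∑-⨁-δ L a (s ⟨$⟩ʳ_) (λ u → lt u (s ⟨$⟩ʳ i)))))
                       (trans (cong ((b xor ⨁pairs g L) xor_) (∧-distribˡ-⨁ (a i) L _))
                              (xor-assoc b (⨁pairs g L) (⨁ L (g i)))))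
  entries : ∀ u → (∑ λ i → a i ∧ e (s ⟨$⟩ʳ i) u) ≡ actᵥ s a u
  entries u = trans (∑-cong (λ i → trans (∧-comm (a i) _) (cong (_∧ a i) (≟-shift s u i))))
                    (∑-δ (s ⟨$⟩ˡ u) a)
  triangle : (∑ λ i → ∑ λ j → lt i j ∧ g i j) ≡ invParity s a
  triangle = trans (∑-cong (λ i → ∑-cong (λ j → reorder (lt i j) (a i) (a j) _)))
                   (sym (bilin-double (inversions s) a a))
    where
    reorder : ∀ l p q m → l ∧ (p ∧ (q ∧ m)) ≡ p ∧ ((l ∧ m) ∧ q)
    reorder = solve-∀ boolRing

actᴴ-cong : {s s' : Perm n} {h h' : Hₙ n} → s ≈ₛ s' → h ≃ᴴ h' → actᴴ s h ≃ᴴ actᴴ s' h'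
actᴴ-cong {n} {s} {s'} {a , b} {a' , b'} s≈s' (a≗a' , b≡b') = begin
  actᴴ s (a , b)                            ≈⟨ actᴴ-closed s a b ⟩
  (actᵥ s a , b xor invParity s a)          ≈⟨ (λ u → trans (cong a (⟨$⟩ˡ-cong {s = s} {s'} s≈s' u)) (a≗a' _))
                                             , cong₂ _xor_ b≡b' (invParity-cong {s = s} {s'} s≈s' a≗a') ⟩
  (actᵥ s' a' , b' xor invParity s' a')     ≈⟨ ≃ᴴ-sym (actᴴ-closed s' a' b') ⟩
  actᴴ s' (a' , b')                         ∎
  where
  open SetoidReasoning (≃ᴴ-setoid n)
  open Setoid (≃ᴴ-setoid n) using () renaming (sym to ≃ᴴ-sym)

·ᴴ-cong : {h₁ h₁' h₂ h₂' : Hₙ n} → h₁ ≃ᴴ h₁' → h₂ ≃ᴴ h₂' → (h₁ ·ᴴ h₂) ≃ᴴ (h₁' ·ᴴ h₂')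
·ᴴ-cong {h₁ = a , b} {a' , b'} {c , d} {c' , d'} (a≗a' , b≡b') (c≗c' , d≡d') =
  (λ i → cong₂ _xor_ (a≗a' i) (c≗c' i))
  , cong₂ _xor_ (cong₂ _xor_ b≡b' d≡d') (bilin-cong (λ _ _ → refl) a≗a' c≗c')

·ᴴ-identityˡ : (h : Hₙ n) → (1ᴴ ·ᴴ h) ≃ᴴ h
·ᴴ-identityˡ {n} (a , b) = (λ _ → refl) , trans (cong (b xor_) (⨁-false (allFin n))) (xor-identityʳ b)

·ᴴ-identityʳ : (h : Hₙ n) → (h ·ᴴ 1ᴴ) ≃ᴴ h
·ᴴ-identityʳ (a , b) = (λ i → xor-identityʳ (a i))
                     , trans (cong₂ _xor_ (xor-identityʳ b) (bilin-0ʳ lt a)) (xor-identityʳ b)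

1ᴴ⁻¹ : 1ᴴ ⁻¹ᴴ ≃ᴴ 1ᴴ {n}
1ᴴ⁻¹ {n} = (λ _ → refl) , ⨁-false (allFin n)

actᴴ-trivial : (s : Perm n) {h : Hₙ n} → h ≃ᴴ 1ᴴ → actᴴ s h ≃ᴴ 1ᴴ
actᴴ-trivial {n} s h≃1 =
  let (p , q) = ≃ᴴ-trans (actᴴ-cong {s = s} {s' = s} (λ _ → refl) h≃1) (actᴴ-closed s 0ᵥ false)
  in p , trans q (⨁-false (allFin n))
  where open Setoid (≃ᴴ-setoid n) using () renaming (trans to ≃ᴴ-trans)

actᴴ-inverse : (π : Perm n) (h : Hₙ n) → actᴴ π (actᴴ (π ⁻¹ₛ) h) ≃ᴴ h
actᴴ-inverse {n} π (a , b) = begin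
  actᴴ π (actᴴ (π ⁻¹ₛ) (a , b))
    ≈⟨ actᴴ-cong {s = π} {s' = π} (λ _ → refl) (actᴴ-closed (π ⁻¹ₛ) a b) ⟩
  actᴴ π (actᵥ (π ⁻¹ₛ) a , b xor invParity (π ⁻¹ₛ) a)
    ≈⟨ actᴴ-closed π _ _ ⟩
  (actᵥ π (actᵥ (π ⁻¹ₛ) a) , (b xor invParity (π ⁻¹ₛ) a) xor invParity π (actᵥ (π ⁻¹ₛ) a))
    ≈⟨ (λ u → cong a (P.inverseʳ π))
     , trans (cong ((b xor invParity (π ⁻¹ₛ) a) xor_) (invParity-inverse π a)) (xor-cancelʳ b _) ⟩
  (a , b) ∎
  where open SetoidReasoning (≃ᴴ-setoid n)

φ-permᴮ : (σ : Perm n) (τ : Bₙ n) → (permᴮ σ ·ᴮ τ) ≈ᴮ (τ ·ᴮ permᴮ σ) →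
          φ (permᴮ σ) τ ≈ᴳ ((0ᵥ , invParity σ (vec τ)) ,ᴳ idₛ)
φ-permᴮ {n} σ (a ,ᴮ π) (σa≗a , σπ≈πσ) = proj₁ hpart≃ , proj₂ hpart≃ , λ i → trans (ρ≈π _) (P.inverseʳ π)
  where
  open SetoidReasoning (≃ᴴ-setoid n)
  ρ≈π : ((σ ∘ₛ π) ∘ₛ (σ ⁻¹ₛ)) ≈ₛ π
  ρ≈π i = trans (σπ≈πσ (σ ⟨$⟩ˡ i)) (cong (π ⟨$⟩ʳ_) (P.inverseʳ σ))
  hpart≃ : hpart (φ (permᴮ σ) (a ,ᴮ π)) ≃ᴴ (0ᵥ , invParity σ a)
  hσ = actᴴ σ (a , false)
  hτ⁻¹ = actᴴ (π ⁻¹ₛ) (a , cocycle a a)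
  hpart≃ = begin
    ((1ᴴ ·ᴴ hσ) ·ᴴ actᴴ (σ ∘ₛ π) (actᴴ (σ ⁻¹ₛ) (1ᴴ ⁻¹ᴴ))) ·ᴴ actᴴ ((σ ∘ₛ π) ∘ₛ (σ ⁻¹ₛ)) hτ⁻¹
      ≈⟨ ·ᴴ-cong {h₁' = hσ ·ᴴ 1ᴴ} (·ᴴ-cong {h₁' = hσ} {h₂' = 1ᴴ} (·ᴴ-identityˡ hσ)
                                          (actᴴ-trivial (σ ∘ₛ π) (actᴴ-trivial (σ ⁻¹ₛ) 1ᴴ⁻¹)))
                                 (actᴴ-cong {s = (σ ∘ₛ π) ∘ₛ (σ ⁻¹ₛ)} {π} {h' = hτ⁻¹} ρ≈π
                                            ((λ _ → refl) , refl)) ⟩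
    (hσ ·ᴴ 1ᴴ) ·ᴴ actᴴ π hτ⁻¹
      ≈⟨ ·ᴴ-cong {h₁' = hσ} {h₂' = a , cocycle a a} (·ᴴ-identityʳ hσ) (actᴴ-inverse π (a , cocycle a a)) ⟩
    hσ ·ᴴ (a , cocycle a a)
      ≈⟨ ·ᴴ-cong {h₁' = a , invParity σ a} {h₂' = a , cocycle a a}
                 (≃ᴴ-trans (actᴴ-closed σ a false) ((λ i → trans (σa≗a i) (xor-identityʳ (a i))) , refl))
                 ((λ _ → refl) , refl) ⟩
    (a , invParity σ a) ·ᴴ (a , cocycle a a)
      ≈⟨ (λ i → xor-same (a i)) , xor-cancelʳ (invParity σ a) (cocycle a a) ⟩
    (0ᵥ , invParity σ a) ∎
    where open Setoid (≃ᴴ-setoid n) using () renaming (trans to ≃ᴴ-trans)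

sucMod-inject₁ : (k : Fin m) → sucMod (inject₁ k) ≡ suc k
sucMod-inject₁ {m} k with toℕ (inject₁ k) <? m
... | yes k<m = toℕ-injective (trans (toℕ-fromℕ< (s≤s k<m)) (cong suc (toℕ-inject₁ k)))
... | no  k≮m = ⊥-elim (k≮m (subst (_< m) (sym (toℕ-inject₁ k)) (toℕ<n k)))

sucMod-fromℕ : ∀ m → sucMod (fromℕ m) ≡ zero
sucMod-fromℕ m with toℕ (fromℕ m) <? m
... | yes m<m = ⊥-elim (ℕ.<-irrefl (toℕ-fromℕ m) m<m)
... | no  _   = refl

tabulate-snoc : (f : Fin (suc m) → A) → tabulate f ≡ tabulate (f ∘ inject₁) ++ [ f (fromℕ m) ]
tabulate-snoc {zero}  f = refl
tabulate-snoc {suc m} f = cong (f zero ∷_) (tabulate-snoc (f ∘ suc))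

⨁pairs-rotate : (h : Fin (suc m) → Fin (suc m) → Bool) →
                ⨁pairs (λ k k' → h (sucMod k) (sucMod k')) (allFin (suc m))
                  ≡ ⨁pairs (λ k k' → h (suc k) (suc k')) (allFin m) xor ∑ (λ k → h (suc k) zero)
⨁pairs-rotate {m} h = begin
  ⨁pairs g (allFin (suc m))
    ≡⟨ cong (⨁pairs g) (tabulate-snoc id) ⟩
  ⨁pairs g (tabulate inject₁ ++ [ fromℕ m ])
    ≡⟨ ⨁pairs-snoc (tabulate inject₁) (fromℕ m) g ⟩
  ⨁pairs g (tabulate inject₁) xor ⨁ (tabulate inject₁) (λ k → g k (fromℕ m))
    ≡⟨ cong₂ _xor_ (trans (⨁pairs-tabulate inject₁ g)
                          (⨁pairs-cong (allFin m) (λ k k' → cong₂ h (sucMod-inject₁ k) (sucMod-inject₁ k'))))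
                   (trans (⨁-tabulate inject₁ (λ k → g k (fromℕ m)))
                          (∑-cong (λ k → cong₂ h (sucMod-inject₁ k) (sucMod-fromℕ m)))) ⟩
  ⨁pairs (λ k k' → h (suc k) (suc k')) (allFin m) xor ∑ (λ k → h (suc k) zero) ∎
  where
  open ≡-Reasoning
  g = λ k k' → h (sucMod k) (sucMod k')

IsCycle : Perm n → (Fin m → Fin n) → Set
IsCycle σ y = ∀ k → σ ⟨$⟩ʳ y k ≡ y (sucMod k)

cycle-constant : {σ : Perm n} {y : Fin m → Fin n} → IsCycle σ y →
                 (b : Fin n → Bool) → (∀ x → b (σ ⟨$⟩ʳ x) ≡ b x) → ∀ k k' → b (y k) ≡ b (y k')
cycle-constant {m = suc m} {σ} {y} cyc b invariant k k' = trans (to-zero k) (sym (to-zero k'))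
  where
  to-zero : ∀ k → b (y k) ≡ b (y zero)
  to-zero = <-weakInduction (λ k → b (y k) ≡ b (y zero)) refl
    (λ k ih → trans (cong (b ∘ y) (sym (sucMod-inject₁ k)))
                    (trans (cong b (sym (cyc (inject₁ k)))) (trans (invariant _) ih)))

-- Rotating the points of a cycle by one place only moves the first point to the end, which flips
-- its order relative to each of the other m − 1 points.
⨁pairs-order-rotation : (y : Fin m → Fin n) → (∀ k k' → y k ≡ y k' → k ≡ k') →
  ⨁pairs (λ k k' → lt (y (sucMod k)) (y (sucMod k'))) (allFin m) xor ⨁pairs (λ k k' → lt (y k) (y k')) (allFin m)
    ≡ parity (m ∸ 1)
⨁pairs-order-rotation {zero}  y _           = refl
⨁pairs-order-rotation {suc m} y y-injective = begin
  ⨁pairs (λ k k' → lt (y (sucMod k)) (y (sucMod k'))) (allFin (suc m))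
    xor ⨁pairs (λ k k' → lt (y k) (y k')) (allFin (suc m))
    ≡⟨ cong₂ _xor_ (⨁pairs-rotate (λ k k' → lt (y k) (y k'))) (⨁pairs-allFin-suc (λ k k' → lt (y k) (y k'))) ⟩
  (T xor R) xor (T xor F)
    ≡⟨ trans (xor-interchange T R T F) (cong (_xor (R xor F)) (xor-same T)) ⟩
  R xor F
    ≡⟨ sym (⨁-xor (allFin m) _ _) ⟩
  ∑ (λ k → lt (y (suc k)) (y zero) xor lt (y zero) (y (suc k)))
    ≡⟨ ∑-cong (λ k → flip-xor (0≢1+n ∘ y-injective zero (suc k))) ⟩
  ∑ {m} (λ _ → true)
    ≡⟨ ∑-true m ⟩
  parity m ∎
  where
  open ≡-Reasoning
  T = ⨁pairs (λ k k' → lt (y (suc k)) (y (suc k'))) (allFin m)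
  R = ∑ (λ k → lt (y (suc k)) (y zero))
  F = ∑ (λ k → lt (y zero) (y (suc k)))
  flip-xor : {x y : Fin n} → x ≢ y → lt y x xor lt x y ≡ true
  flip-xor {x = x} {y} x≢y =
    trans (cong (_xor lt x y) (lt-flip x≢y)) (trans (xor-comm (not (lt x y)) (lt x y)) (xor-inverseʳ (lt x y)))

invParity-cycle : {σ : Perm n} {y : Fin m → Fin n} → IsCycle σ y → (∀ k k' → y k ≡ y k' → k ≡ k') →
                  invParity σ (vsum (allFin m) (e ∘ y)) ≡ parity (m ∸ 1)
invParity-cycle {n} {m} {σ} {y} cyc y-injective = begin
  invParity σ (vsum (allFin m) (e ∘ y))
    ≡⟨ quad-vsum (inversions σ) (allFin m) (e ∘ y) ⟩
  ⨁ (allFin m) (λ k → quad (inversions σ) (e (y k))) xor ⨁pairs (λ k k' → bilin S (e (y k)) (e (y k'))) (allFin m)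
    ≡⟨ cong₂ _xor_ (trans (∑-cong diagonal) (⨁-false (allFin m)))
                   (⨁pairs-cong (allFin m) (λ k k' → trans (bilin-e S (y k) (y k'))
                                                           (inversions-symmetrized σ (y k) (y k')))) ⟩
  ⨁pairs (λ k k' → lt (σ ⟨$⟩ʳ y k) (σ ⟨$⟩ʳ y k') xor lt (y k) (y k')) (allFin m)
    ≡⟨ trans (⨁pairs-cong (allFin m) (λ k k' → cong₂ (λ u v → lt u v xor lt (y k) (y k')) (cyc k) (cyc k')))
             (⨁pairs-xor (allFin m) _ _) ⟩
  ⨁pairs (λ k k' → lt (y (sucMod k)) (y (sucMod k'))) (allFin m) xor ⨁pairs (λ k k' → lt (y k) (y k')) (allFin m)
    ≡⟨ ⨁pairs-order-rotation y y-injective ⟩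
  parity (m ∸ 1) ∎
  where
  open ≡-Reasoning
  S = inversions σ +ᶠ inversions σ ᵀ
  diagonal : ∀ k → quad (inversions σ) (e (y k)) ≡ false
  diagonal k =
    trans (bilin-e (inversions σ) (y k) (y k)) (cong (_∧ lt (σ ⟨$⟩ʳ y k) (σ ⟨$⟩ʳ y k)) (lt-irrefl (y k)))

module _ {σ : Perm n} (D : CycleDecomp n σ) where

  firstIndex : (r : Fin (j D)) → Fin (d D r)
  firstIndex r = fromℕ< (d-pos D r)

  idx-injective : ∀ r {k k'} → idx D r k ≡ idx D r k' → k ≡ k'
  idx-injective r {k} {k'} eq = toℕ-injective (proj₂ (idx-inj D r r k k' eq))

  cycleIndicator : Fin (j D) → Vec₂ n
  cycleIndicator r = vsum (allFin (d D r)) (e ∘ idx D r)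

  cycleIndicator-idx : ∀ r r' k' → cycleIndicator r (idx D r' k') ≡ does (r ≟ r')
  cycleIndicator-idx r r' k' with r ≟ r'
  ... | yes refl =
    trans (vsum-apply (allFin (d D r)) (e ∘ idx D r) (idx D r k'))
          (trans (∑-cong (λ k → trans (does-⇔ (mk⇔ (sym ∘ idx-injective r) (cong (idx D r) ∘ sym))
                                                                (idx D r k' ≟ idx D r k) (k ≟ k'))
                                                       (sym (∧-identityʳ _))))
                 (∑-δ k' (λ _ → true)))
  ... | no r≢r' =
    trans (vsum-apply (allFin (d D r)) (e ∘ idx D r) (idx D r' k'))
          (trans (∑-cong (λ k → dec-false (idx D r' k' ≟ idx D r k)
                                                           (λ eq → r≢r' (sym (proj₁ (idx-inj D r' r k' k eq))))))
                 (⨁-false (allFin (d D r))))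

  cycleVec-idx : ∀ λ′ r k → cycleVec D λ′ (idx D r k) ≡ λ′ r
  cycleVec-idx λ′ r k =
    trans (vsum-apply (allFin (j D)) _ (idx D r k))
          (trans (∑-cong (λ r' → trans (if-apply (λ′ r') (cycleIndicator r'))
                                                      (cong (λ′ r' ∧_) (cycleIndicator-idx r' r k))))
                 (∑-∧-δ r λ′))
    where
    if-apply : ∀ c (v : Vec₂ n) → (if c then v else 0ᵥ) (idx D r k) ≡ c ∧ v (idx D r k)
    if-apply true  v = refl
    if-apply false v = refl

  cycleIndicator-invariant : ∀ r u → cycleIndicator r (σ ⟨$⟩ˡ u) ≡ cycleIndicator r u
  cycleIndicator-invariant r u with idx-surj D (σ ⟨$⟩ˡ u)
  ... | r₁ , k₁ , eq =
    trans (cong (cycleIndicator r) (sym eq))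
          (trans (cycleIndicator-idx r r₁ k₁)
                 (sym (trans (cong (cycleIndicator r) u≡next) (cycleIndicator-idx r r₁ (sucMod k₁)))))
    where
    u≡next : u ≡ idx D r₁ (sucMod k₁)
    u≡next = trans (sym (P.inverseʳ σ)) (trans (cong (σ ⟨$⟩ʳ_) (sym eq)) (cyclic D r₁ k₁))

  module _ {π : Perm n} (σπ≈πσ : (σ ∘ₛ π) ≈ₛ (π ∘ₛ σ)) where

    ⟨$⟩ˡ-commute : ∀ u → π ⟨$⟩ˡ (σ ⟨$⟩ˡ u) ≡ σ ⟨$⟩ˡ (π ⟨$⟩ˡ u)
    ⟨$⟩ˡ-commute u = begin
      π ⟨$⟩ˡ (σ ⟨$⟩ˡ u)                                    ≡⟨ sym (P.inverseˡ σ) ⟩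
      σ ⟨$⟩ˡ (σ ⟨$⟩ʳ w)                                    ≡⟨ cong (σ ⟨$⟩ˡ_) (sym (P.inverseˡ π)) ⟩
      σ ⟨$⟩ˡ (π ⟨$⟩ˡ (π ⟨$⟩ʳ (σ ⟨$⟩ʳ w)))                  ≡⟨ cong (λ x → σ ⟨$⟩ˡ (π ⟨$⟩ˡ x)) (sym (σπ≈πσ w)) ⟩
      σ ⟨$⟩ˡ (π ⟨$⟩ˡ (σ ⟨$⟩ʳ (π ⟨$⟩ʳ w)))                  ≡⟨ cong (λ x → σ ⟨$⟩ˡ (π ⟨$⟩ˡ (σ ⟨$⟩ʳ x))) (P.inverseʳ π) ⟩
      σ ⟨$⟩ˡ (π ⟨$⟩ˡ (σ ⟨$⟩ʳ (σ ⟨$⟩ˡ u)))                  ≡⟨ cong (λ x → σ ⟨$⟩ˡ (π ⟨$⟩ˡ x)) (P.inverseʳ σ) ⟩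
      σ ⟨$⟩ˡ (π ⟨$⟩ˡ u)                                    ∎
      where
      open ≡-Reasoning
      w = π ⟨$⟩ˡ (σ ⟨$⟩ˡ u)

    translatedCycle : Fin (j D) → Vec₂ n
    translatedCycle r = actᵥ π (cycleIndicator r)

    translatedCycle-invariant : ∀ r u → translatedCycle r (σ ⟨$⟩ˡ u) ≡ translatedCycle r u
    translatedCycle-invariant r u =
      trans (cong (cycleIndicator r) (⟨$⟩ˡ-commute u)) (cycleIndicator-invariant r (π ⟨$⟩ˡ u))

    invParity-translatedCycle : ∀ r → invParity σ (translatedCycle r) ≡ parity (d D r ∸ 1)
    invParity-translatedCycle r =
      trans (invParity-congʳ σ as-vsum)
            (invParity-cycle {σ = σ} (λ k → trans (σπ≈πσ _) (cong (π ⟨$⟩ʳ_) (cyclic D r k)))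
                             (λ k k' → idx-injective r ∘ Injection.injective (↔⇒↣ π)))
      where
      as-vsum : ∀ u → translatedCycle r u ≡ vsum (allFin (d D r)) (e ∘ (π ⟨$⟩ʳ_) ∘ idx D r) u
      as-vsum u = trans (vsum-apply (allFin (d D r)) _ (π ⟨$⟩ˡ u))
                        (trans (∑-cong (λ k → trans (≟-sym (π ⟨$⟩ˡ u) (idx D r k))
                                                                     (sym (≟-shift π u (idx D r k)))))
                               (sym (vsum-apply (allFin (d D r)) _ u)))

    invParity-translated-cycleVec : ∀ λ′ → invParity σ (actᵥ π (cycleVec D λ′)) ≡ parity (exponent D λ′)
    invParity-translated-cycleVec λ′ =
      trans (invParity-congʳ σ as-vsum)
            (trans (invParity-vsum-invariant σ (allFin (j D)) v (λ r → invariant (λ′ r) r))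
                   (trans (∑-cong (λ r → summand (λ′ r) r))
                          (sym (parity-sum _ (allFin (j D))))))
      where
      v : Fin (j D) → Vec₂ n
      v r = if λ′ r then translatedCycle r else 0ᵥ
      as-vsum : ∀ u → actᵥ π (cycleVec D λ′) u ≡ vsum (allFin (j D)) v u
      as-vsum u = trans (vsum-apply (allFin (j D)) _ (π ⟨$⟩ˡ u))
                        (trans (∑-cong (λ r → translate (λ′ r) r)) (sym (vsum-apply (allFin (j D)) v u)))
        where
        translate : ∀ c r → (if c then cycleIndicator r else 0ᵥ) (π ⟨$⟩ˡ u)
                            ≡ (if c then translatedCycle r else 0ᵥ) u
        translate true  r = refl
        translate false r = refl
      invariant : ∀ c r u → (if c then translatedCycle r else 0ᵥ) (σ ⟨$⟩ˡ u)
                          ≡ (if c then translatedCycle r else 0ᵥ) u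
      invariant true  r = translatedCycle-invariant r
      invariant false r u = refl
      summand : ∀ c r → invParity σ (if c then translatedCycle r else 0ᵥ)
                        ≡ parity (if c then d D r ∸ 1 else 0)
      summand true  r = invParity-translatedCycle r
      summand false r = ⨁-false (allFin n)

  coefficients : Bₙ n → Fin (j D) → Bool
  coefficients τ r = vec τ (perm τ ⟨$⟩ʳ idx D r (firstIndex r))

  decomposition-exists : (τ : Bₙ n) → (permᴮ σ ·ᴮ τ) ≈ᴮ (τ ·ᴮ permᴮ σ) →
                         IsDecomposition D τ (perm τ) (coefficients τ)
  decomposition-exists (a ,ᴮ π) (σa≗a , σπ≈πσ) =
    σπ≈πσ , (λ i → sym (trans (cycleVec-on-cycles (π ⟨$⟩ˡ i)) (cong a (P.inverseʳ π)))) , (λ _ → refl)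
    where
    a-invariant : ∀ y → a (σ ⟨$⟩ʳ y) ≡ a y
    a-invariant y = sym (trans (cong a (sym (P.inverseˡ σ))) (trans (σa≗a (σ ⟨$⟩ʳ y)) (xor-identityʳ _)))
    aπ-invariant : ∀ x → a (π ⟨$⟩ʳ (σ ⟨$⟩ʳ x)) ≡ a (π ⟨$⟩ʳ x)
    aπ-invariant x = trans (cong a (sym (σπ≈πσ x))) (a-invariant _)
    cycleVec-on-cycles : ∀ w → cycleVec D (coefficients (a ,ᴮ π)) w ≡ a (π ⟨$⟩ʳ w)
    cycleVec-on-cycles w with idx-surj D w
    ... | r , k , refl =
      trans (cycleVec-idx (coefficients (a ,ᴮ π)) r k)
            (cycle-constant {σ = σ} (cyclic D r) (a ∘ (π ⟨$⟩ʳ_)) aπ-invariant (firstIndex r) k)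

  decomposition-coefficient : ∀ τ τ' λ′ → IsDecomposition D τ τ' λ′ →
                              ∀ r k → λ′ r ≡ vec τ (τ' ⟨$⟩ʳ idx D r k)
  decomposition-coefficient τ τ' λ′ (_ , a≗ , _) r k =
    trans (sym (cycleVec-idx λ′ r k)) (trans (cong (cycleVec D λ′) (sym (P.inverseˡ τ'))) (sym (a≗ _)))

  decomposition-unique : (τ : Bₙ n) → ∀ τ₁ λ₁ τ₂ λ₂ → IsDecomposition D τ τ₁ λ₁ → IsDecomposition D τ τ₂ λ₂ →
                         (τ₁ ≈ₛ τ₂) × (∀ r → λ₁ r ≡ λ₂ r)
  decomposition-unique τ τ₁ λ₁ τ₂ λ₂ dec₁@(_ , _ , π≈τ₁) dec₂@(_ , _ , π≈τ₂) = τ₁≈τ₂ , λ₁≗λ₂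
    where
    τ₁≈τ₂ : τ₁ ≈ₛ τ₂
    τ₁≈τ₂ i = trans (sym (π≈τ₁ i)) (π≈τ₂ i)
    λ₁≗λ₂ : ∀ r → λ₁ r ≡ λ₂ r
    λ₁≗λ₂ r = trans (decomposition-coefficient τ τ₁ λ₁ dec₁ r (firstIndex r))
                    (trans (cong (vec τ) (τ₁≈τ₂ _))
                           (sym (decomposition-coefficient τ τ₂ λ₂ dec₂ r (firstIndex r))))

corollary2p4 : (n : ℕ) → 0 < n → (σ : Perm n) → (D : CycleDecomp n σ) →
               (τ : Bₙ n) → ((permᴮ σ ·ᴮ τ) ≈ᴮ (τ ·ᴮ permᴮ σ)) →
               (Σ (Perm n) λ τ' → Σ (Fin (j D) → Bool) λ λ′ →
                  IsDecomposition D τ τ' λ′ × (φ (permᴮ σ) τ ≈ᴳ εᴳ^ (exponent D λ′)))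
               × (∀ τ₁ λ₁ τ₂ λ₂ → IsDecomposition D τ τ₁ λ₁ → IsDecomposition D τ τ₂ λ₂ →
                  (τ₁ ≈ₛ τ₂) × (∀ r → λ₁ r ≡ λ₂ r))
corollary2p4 n _ σ D τ στ≈τσ =
  (perm τ , coefficients D τ , decomposition , φ≈ε) , decomposition-unique D τ
  where
  decomposition = decomposition-exists D τ στ≈τσ
  inversions≡exponent : invParity σ (vec τ) ≡ parity (exponent D (coefficients D τ))
  inversions≡exponent =
    trans (invParity-congʳ σ (proj₁ (proj₂ decomposition)))
          (invParity-translated-cycleVec D {π = perm τ} (proj₁ decomposition) (coefficients D τ))
  φ≈ε : φ (permᴮ σ) τ ≈ᴳ εᴳ^ (exponent D (coefficients D τ))
  φ≈ε = let (vec≗ , parity≡ , perm≈) = φ-permᴮ σ τ στ≈τσ in vec≗ , trans parity≡ inversions≡exponent , perm≈
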